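{- A slice of a mincut of $\Gamma$ has empty intersection with every mincut of $\Gamma$. Distinct slices (of possibly different mincuts) are disjoint. If $Q$ is a slice, then no two elements of $\partial Q$ are separated by any mincut.
   Context: $\Gamma=(V,E)$ is a connected graph. For $K\subseteq V$, $\Gamma-K$ is $\Gamma$ with $K$ and incident edges deleted. A vertex cut is a finite $K\subseteq V$ with $\Gamma-K$ disconnected. A ray is an infinite sequence of distinct vertices with consecutive ones adjacent; rays $r_1,r_2$ are equivalent if for every vertex cut $K$ all but finitely many vertices of $r_1\cup r_2$ lie in one component of $\Gamma-K$; ends are the equivalence classes. An end cut is a vertex cut $K$ such that at least two components of $\Gamma-K$ contain rays; it is assumed end cuts exist, and a mincut is an end cut of minimal cardinality. For a mincut $K$, a component of $\Gamma-K$ is proper if it contains a ray and is a slice if it does not. For a set $Q$ of vertices, $\partial Q$ is the set of vertices not in $Q$ adjacent to a vertex of $Q$. A set $L$ separates vertices $x,y$ if every path from $x$ to $y$ meets $L$. -}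

module Defs where

open import Data.Nat using (ℕ; suc; _≤_)
open import Data.List using (List; []; _∷_; length)
open import Data.List.Membership.Propositional using (_∈_; _∉_)
open import Data.List.Relation.Unary.All using (All)
open import Data.List.Relation.Unary.Any using (Any)
open import Data.List.Relation.Unary.Unique.Propositional using (Unique)
open import Data.Product using (Σ; ∃; _×_; _,_)
open import Relation.Binary.PropositionalEquality using (_≡_; _≢_)
open import Relation.Nullary using (¬_)
open import Function.Bundles using (_⇔_)
open import Function.Definitions using (Injective)

record Graph : Set₁ where
  field
    V     : Set
    _~_   : V → V → Set
    ~-sym : ∀ {x y} → x ~ y → y ~ x
    ~-irr : ∀ {x} → ¬ (x ~ x)

module _ (G : Graph) where
  open Graph G

  data Walk : V → V → Set where
    []  : ∀ {x} → Walk x x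
    _∷_ : ∀ {x y z} → x ~ y → Walk y z → Walk x z

  verts : ∀ {x z} → Walk x z → List V
  verts {x} []      = x ∷ []
  verts {x} (_ ∷ w) = x ∷ verts w

  inner : ∀ {x z} → Walk x z → List V
  inner []                         = []
  inner (e ∷ [])                   = []
  inner (_∷_ {y = y} e (e′ ∷ w))   = y ∷ inner (e′ ∷ w)

  Connected : Set
  Connected = ∀ x y → Walk x y

  -- finite vertex sets are lists; x and y are joined by a walk in Γ - K
  Reach : List V → V → V → Set
  Reach K x y = Σ (Walk x y) λ w → All (λ v → v ∉ K) (verts w)

  IsComponent : List V → (V → Set) → Set
  IsComponent K Q = Σ V λ v → (v ∉ K) × (∀ w → Q w ⇔ Reach K v w)

  SameSet : (V → Set) → (V → Set) → Set
  SameSet P Q = ∀ w → P w ⇔ Q w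

  Disconnected : List V → Set
  Disconnected K = Σ V λ x → Σ V λ y → (x ∉ K) × (y ∉ K) × ¬ Reach K x y

  IsVertexCut : List V → Set
  IsVertexCut K = Disconnected K

  record Ray : Set where
    field
      seq  : ℕ → V
      inj  : Injective _≡_ _≡_ seq
      adj  : ∀ n → seq n ~ seq (suc n)

  ContainsRay : (V → Set) → Set
  ContainsRay Q = Σ Ray λ r → ∀ n → Q (Ray.seq r n)

  IsEndCut : List V → Set
  IsEndCut K = IsVertexCut K ×
    Σ V λ v₁ → Σ V λ v₂ → (v₁ ∉ K) × (v₂ ∉ K) × ¬ Reach K v₁ v₂ ×
      ContainsRay (Reach K v₁) × ContainsRay (Reach K v₂)

  EndCutsExist : Set
  EndCutsExist = Σ (List V) IsEndCut

  -- a mincut: an end cut (listed without repetition) of minimal cardinality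
  IsMincut : List V → Set
  IsMincut K = Unique K × IsEndCut K × (∀ K′ → IsEndCut K′ → length K ≤ length K′)

  IsSlice : List V → (V → Set) → Set
  IsSlice K Q = IsMincut K × IsComponent K Q × ¬ ContainsRay Q

  ∂ : (V → Set) → V → Set
  ∂ Q x = ¬ Q x × Σ V λ y → Q y × (x ~ y)

  Separates : List V → V → V → Set
  Separates L x y = (w : Walk x y) → Any (λ v → v ∈ L) (inner w)

-- Two mincuts K and L cut the graph into corners C_K(a) ∩ C_L(a). If a corner contains a ray
-- and another ray lies outside it, the vertices of K ∪ L bounding the corner form an end cut, so
-- there are at least |K| of them. Suppose a vertex x of a slice of K lies in a mincut L. Tails of
-- the rays that make K and L end cuts yield two rays a, b separated by both K and L; the bounds
-- for the corners of a and b count each vertex of K at most once and each vertex of L other than x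
-- at most once, so 2|K| ≤ |K| + |L| - 1, a contradiction. Hence slices avoid all mincuts, so a
-- slice stays connected after deleting any mincut, which gives the other two statements.
-- Classical case distinctions are made under double negation: every claim proved is a negation.

module Submission where

open import Defs
open import Algebra.Properties.CommutativeSemigroup using (interchange)
open import Data.Empty using (⊥; ⊥-elim)
open import Data.List using (List; []; _∷_; length; _++_)
open import Data.List.Membership.Propositional using (_∈_; _∉_)
open import Data.List.Membership.Propositional.Properties using (∈-++⁺ˡ; ∈-++⁺ʳ)
open import Data.List.Properties using (length-++)
open import Data.List.Relation.Binary.Subset.Propositional using (_⊆_)
open import Data.List.Relation.Binary.Subset.Propositional.Properties using (++⁺; xs⊆xs++ys; xs⊆ys++xs)
open import Data.List.Relation.Unary.All as All using (All; []; _∷_)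
open import Data.List.Relation.Unary.Any using (Any; here; there)
open import Data.Nat using (ℕ; zero; suc; _+_; _≤_; _<_; _⊔_; z≤n; s≤s)
open import Data.Nat.Properties
open import Data.Product using (Σ; _×_; _,_; proj₁; proj₂)
open import Data.Sum using (_⊎_; inj₁; inj₂; [_,_]′)
open import Effect.Monad using (RawMonad)
open import Function using (_∘_)
open import Function.Bundles using (_⇔_; mk⇔; Equivalence)
open import Level using (0ℓ)
open import Relation.Binary.Definitions using (Symmetric; Transitive)
open import Relation.Binary.PropositionalEquality using (_≡_; _≢_; refl; sym; trans; cong; subst)
open import Relation.Nullary using (¬_; Dec; yes; no; contradiction)
open import Relation.Nullary.Decidable using (_⊎-dec_; ¬¬-excluded-middle)
open import Relation.Nullary.Negation using (¬¬-Monad; ¬¬-map; negated-stable)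

open RawMonad (¬¬-Monad {0ℓ})

module _ {A : Set} {T : A → A → Set} (T-sym : Symmetric T) (T-trans : Transitive T) where

  separated-from-one : ∀ {p q} → ¬ T p q → ∀ r → ¬ ¬ (¬ T r p ⊎ ¬ T r q)
  separated-from-one {p} {q} ¬pq r = ¬¬-map side ¬¬-excluded-middle
    where
    side : Dec (T r p) → ¬ T r p ⊎ ¬ T r q
    side (yes rp) = inj₂ (λ rq → ¬pq (T-trans (T-sym rp) rq))
    side (no ¬rp) = inj₁ ¬rp

module _ {A : Set} {R S : A → A → Set}
         (R-sym : Symmetric R) (R-trans : Transitive R)
         (S-sym : Symmetric S) (S-trans : Transitive S) where

  separated-by-both : ∀ t₁ t₂ u₁ u₂ → ¬ R t₁ t₂ → ¬ S u₁ u₂ →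
    ¬ ¬ (Σ A λ a → Σ A λ b → ¬ R a b × ¬ S a b)
  separated-by-both t₁ t₂ u₁ u₂ ¬Rt ¬Su k = ¬¬-excluded-middle λ where
      (no ¬St) → k (t₁ , t₂ , ¬Rt , ¬St)
      (yes St) → separated-from-one {T = S} S-sym S-trans ¬Su t₁ λ where
        (inj₁ ¬St₁u₁) → pair St u₁ ¬St₁u₁
        (inj₂ ¬St₁u₂) → pair St u₂ ¬St₁u₂
    where
    pair : S t₁ t₂ → ∀ u → ¬ S t₁ u → ⊥
    pair St u ¬St₁u = separated-from-one {T = R} R-sym R-trans ¬Rt u λ where
      (inj₁ ¬Rut₁) → k (t₁ , u , ¬Rut₁ ∘ R-sym , ¬St₁u)
      (inj₂ ¬Rut₂) → k (t₂ , u , ¬Rut₂ ∘ R-sym , ¬St₁u ∘ S-trans St)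

module _ {A : Set} where

  Decisions : (A → Set) → List A → Set
  Decisions P = All (Dec ∘ P)

  decisions : ∀ (P : A → Set) xs → ¬ ¬ Decisions P xs
  decisions P xs = All.sequenceM 0ℓ (¬¬-Monad {0ℓ}) (All.tabulate λ _ → ¬¬-excluded-middle)

  _∪?_ : ∀ {P Q : A → Set} {xs} → Decisions P xs → Decisions Q xs → Decisions (λ z → P z ⊎ Q z) xs
  dP ∪? dQ = All.zipWith (λ (p? , q?) → p? ⊎-dec q?) (dP , dQ)

  select : ∀ {P : A → Set} {xs} → Decisions P xs → List A
  select {xs = []}     []            = []
  select {xs = x ∷ xs} (yes _ ∷ ds) = x ∷ select ds
  select {xs = x ∷ xs} (no _  ∷ ds) = select ds

  count : ∀ {P : A → Set} {xs} → Decisions P xs → ℕ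
  count d = length (select d)

  select-⊆ : ∀ {P : A → Set} {xs} (d : Decisions P xs) → select d ⊆ xs
  select-⊆ (yes _ ∷ ds) (here z≡x)  = here z≡x
  select-⊆ (yes _ ∷ ds) (there z∈)  = there (select-⊆ ds z∈)
  select-⊆ (no _  ∷ ds) z∈          = there (select-⊆ ds z∈)

  ∈-select : ∀ {P : A → Set} {xs z} (d : Decisions P xs) → z ∈ xs → P z → z ∈ select d
  ∈-select (yes _  ∷ ds) (here refl) pz = here refl
  ∈-select (no ¬pz ∷ ds) (here refl) pz = contradiction pz ¬pz
  ∈-select (yes _  ∷ ds) (there z∈)  pz = there (∈-select ds z∈ pz)
  ∈-select (no _   ∷ ds) (there z∈)  pz = ∈-select ds z∈ pz

  count≤length : ∀ {P : A → Set} {xs} (d : Decisions P xs) → count d ≤ length xs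
  count≤length []           = z≤n
  count≤length (yes _ ∷ ds) = s≤s (count≤length ds)
  count≤length (no _  ∷ ds) = m≤n⇒m≤1+n (count≤length ds)

  count<length : ∀ {P : A → Set} {xs z} (d : Decisions P xs) → z ∈ xs → ¬ P z → count d < length xs
  count<length (yes pz ∷ ds) (here refl) ¬pz = contradiction pz ¬pz
  count<length (no _   ∷ ds) (here refl) ¬pz = s≤s (count≤length ds)
  count<length (yes _  ∷ ds) (there z∈)  ¬pz = s≤s (count<length ds z∈ ¬pz)
  count<length (no _   ∷ ds) (there z∈)  ¬pz = m≤n⇒m≤1+n (count<length ds z∈ ¬pz)

  count-∪ : ∀ {P Q : A → Set} {xs} (dP : Decisions P xs) (dQ : Decisions Q xs) →
    (∀ {z} → P z → Q z → ⊥) → count (dP ∪? dQ) ≡ count dP + count dQ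
  count-∪ []            []            _        = refl
  count-∪ (yes p ∷ dP)  (yes q ∷ dQ)  disjoint = ⊥-elim (disjoint p q)
  count-∪ (yes _ ∷ dP)  (no _  ∷ dQ)  disjoint = cong suc (count-∪ dP dQ disjoint)
  count-∪ (no _  ∷ dP)  (yes _ ∷ dQ)  disjoint =
    trans (cong suc (count-∪ dP dQ disjoint)) (sym (+-suc (count dP) (count dQ)))
  count-∪ (no _  ∷ dP)  (no _  ∷ dQ)  disjoint = count-∪ dP dQ disjoint

+-bounds-absurd : ∀ {k} p q r s → k ≤ p + q → k ≤ r + s → p + r ≤ k → q + s < k → ⊥
+-bounds-absurd {k} p q r s k≤p+q k≤r+s p+r≤k q+s<k = <-irrefl refl (begin-strict
  k + k              ≤⟨ +-mono-≤ k≤p+q k≤r+s ⟩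
  (p + q) + (r + s)  ≡⟨ interchange +-commutativeSemigroup p q r s ⟩
  (p + r) + (q + s)  <⟨ +-mono-≤-< p+r≤k q+s<k ⟩
  k + k              ∎)
  where open ≤-Reasoning

module _ (G : Graph) where
  open Graph G

  _▷_ : ∀ {x y z} → Walk G x y → y ~ z → Walk G x z
  []      ▷ e = e ∷ []
  (e′ ∷ w) ▷ e = e′ ∷ (w ▷ e)

  inner-▷ : ∀ {x y z u} (e : x ~ y) (w : Walk G y z) (e′ : z ~ u) → inner G (e ∷ (w ▷ e′)) ≡ verts G w
  inner-▷ e []       e′ = refl
  inner-▷ {y = y} e (f ∷ w) e′ = cong (y ∷_) (inner-▷ f w e′)

  All-verts-head : ∀ {P : V → Set} {x y} (w : Walk G x y) → All P (verts G w) → P x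
  All-verts-head []      (px ∷ _) = px
  All-verts-head (_ ∷ _) (px ∷ _) = px

  All-verts-last : ∀ {P : V → Set} {x y} (w : Walk G x y) → All P (verts G w) → P y
  All-verts-last []      (py ∷ _)  = py
  All-verts-last (_ ∷ w) (_ ∷ ps) = All-verts-last w ps

  module _ {S : List V} where

    Reach-refl : ∀ {a} → a ∉ S → Reach G S a a
    Reach-refl a∉S = [] , a∉S ∷ []

    Reach-cons : ∀ {a b c} → a ∉ S → a ~ b → Reach G S b c → Reach G S a c
    Reach-cons a∉S e (w , avoids) = e ∷ w , a∉S ∷ avoids

    Reach-trans : ∀ {a b c} → Reach G S a b → Reach G S b c → Reach G S a c
    Reach-trans ([]    , _)           r = r
    Reach-trans (e ∷ w , a∉S ∷ avoids) r = Reach-cons a∉S e (Reach-trans (w , avoids) r)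

    Reach-start : ∀ {a b} → Reach G S a b → a ∉ S
    Reach-start (w , avoids) = All-verts-head w avoids

    Reach-end : ∀ {a b} → Reach G S a b → b ∉ S
    Reach-end (w , avoids) = All-verts-last w avoids

    StepClosed : (V → Set) → Set
    StepClosed P = ∀ {y z} → P y → y ~ z → z ∉ S → P z

    verts-invariant : ∀ {P : V → Set} → StepClosed P →
      ∀ {a b} (w : Walk G a b) → All (_∉ S) (verts G w) → P a → All P (verts G w)
    verts-invariant step []      _            pa = pa ∷ []
    verts-invariant step (e ∷ w) (_ ∷ avoids) pa =
      pa ∷ verts-invariant step w avoids (step pa e (All-verts-head w avoids))

    Reach-ind : ∀ {P : V → Set} → StepClosed P → ∀ {a b} → P a → Reach G S a b → P b
    Reach-ind step pa (w , avoids) = All-verts-last w (verts-invariant step w avoids pa)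

    Reach-sym : ∀ {a b} → Reach G S a b → Reach G S b a
    Reach-sym {a} r = Reach-ind {P = λ z → Reach G S z a}
      (λ r′ e z∉S → Reach-cons z∉S (~-sym e) r′) (Reach-refl (Reach-start r)) r

    Reach-step : ∀ {a b c} → Reach G S a b → b ~ c → c ∉ S → Reach G S a c
    Reach-step r e c∉S = Reach-trans r (Reach-cons (Reach-end r) e (Reach-refl c∉S))

    Reach-separated : ∀ {a b a′ b′} → ¬ Reach G S a b → Reach G S a a′ → Reach G S b b′ → ¬ Reach G S a′ b′
    Reach-separated ¬ab aa′ bb′ a′b′ = ¬ab (Reach-trans aa′ (Reach-trans a′b′ (Reach-sym bb′)))

  module _ {K : List V} {Q : V → Set} (component : IsComponent G K Q) where

    private
      Q⇔ : ∀ w → Q w ⇔ Reach G K (proj₁ component) w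
      Q⇔ = proj₂ (proj₂ component)

    component-∌ : ∀ {a} → Q a → a ∉ K
    component-∌ qa = Reach-end (Equivalence.to (Q⇔ _) qa)

    component-reach : ∀ {a b} → Q a → Q b → Reach G K a b
    component-reach qa qb =
      Reach-trans (Reach-sym (Equivalence.to (Q⇔ _) qa)) (Equivalence.to (Q⇔ _) qb)

    component-∋ : ∀ {a b} → Q a → Reach G K a b → Q b
    component-∋ qa r = Equivalence.from (Q⇔ _) (Reach-trans (Equivalence.to (Q⇔ _) qa) r)

    component-walk : ∀ {a b} → Q a → (w : Walk G a b) → All (_∉ K) (verts G w) → All Q (verts G w)
    component-walk qa w avoids = verts-invariant (λ qy e z∉K →
      component-∋ qy (Reach-cons (component-∌ qy) e (Reach-refl z∉K))) w avoids qa

  drop : Ray G → ℕ → Ray G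
  drop r N = record
    { seq = λ n → Ray.seq r (n + N)
    ; inj = λ {m} {n} eq → +-cancelʳ-≡ N m n (Ray.inj r eq)
    ; adj = λ n → Ray.adj r (n + N)
    }

  eventually-≢ : (r : Ray G) (s : V) → ¬ ¬ (Σ ℕ λ N → ∀ n → N ≤ n → Ray.seq r n ≢ s)
  eventually-≢ r s = ¬¬-map after ¬¬-excluded-middle
    where
    after : Dec (Σ ℕ λ m → Ray.seq r m ≡ s) → Σ ℕ λ N → ∀ n → N ≤ n → Ray.seq r n ≢ s
    after (yes (m , rm≡s)) = suc m , λ n m<n rn≡s → <⇒≢ m<n (Ray.inj r (trans rm≡s (sym rn≡s)))
    after (no ¬hit)        = 0 , λ n _ rn≡s → ¬hit (n , rn≡s)

  eventually-avoids : (r : Ray G) (S : List V) → ¬ ¬ (Σ ℕ λ N → ∀ n → N ≤ n → Ray.seq r n ∉ S)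
  eventually-avoids r []      = pure (0 , λ _ _ ())
  eventually-avoids r (s ∷ S) = do
    (N₁ , ≢s) ← eventually-≢ r s
    (N₂ , ∉S) ← eventually-avoids r S
    pure (N₁ ⊔ N₂ , λ where
      n N≤n (here rn≡s) → ≢s n (≤-trans (m≤m⊔n N₁ N₂) N≤n) rn≡s
      n N≤n (there rn∈S) → ∉S n (≤-trans (m≤n⊔m N₁ N₂) N≤n) rn∈S)

  record AvoidingRay (S : List V) : Set where
    field
      ray    : Ray G
      avoids : ∀ n → Ray.seq ray n ∉ S

    start : V
    start = Ray.seq ray 0

  open AvoidingRay

  restrict : ∀ {S M} → M ⊆ S → AvoidingRay S → AvoidingRay M
  restrict M⊆S a = record { ray = ray a ; avoids = λ n → avoids a n ∘ M⊆S }

  avoiding-tail : ∀ S (P : V → Set) (r : Ray G) → (∀ n → P (Ray.seq r n)) →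
    ¬ ¬ (Σ (AvoidingRay S) (P ∘ start))
  avoiding-tail S P r P-along = do
    (N , ∉S) ← eventually-avoids r S
    pure (record { ray = drop r N ; avoids = λ n → ∉S (n + N) (m≤n+m N n) } , P-along N)

  ray-reach : ∀ {S} (a : AvoidingRay S) n → Reach G S (start a) (Ray.seq (ray a) n)
  ray-reach a zero    = Reach-refl (avoids a 0)
  ray-reach a (suc n) = Reach-step (ray-reach a n) (Ray.adj (ray a) n) (avoids a (suc n))

  rayless-unreachable : ∀ {K Q x} → IsComponent G K Q → ¬ ContainsRay G Q → Q x →
    (a : AvoidingRay K) → ¬ Reach G K (start a) x
  rayless-unreachable component rayless qx a ax =
    rayless (ray a , λ n → component-∋ component qx (Reach-trans (Reach-sym ax) (ray-reach a n)))

  module _ {K L : List V} where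

    Corner : V → V → Set
    Corner a z = Reach G K a z × Reach G L a z

    -- Every vertex of K ∪ L adjacent to the corner C_K(a) ∩ C_L(a) satisfies this.
    CornerBoundary : V → V → Set
    CornerBoundary a z = (z ∈ K × Reach G L a z) ⊎ (z ∈ K × z ∈ L) ⊎ (z ∈ L × Reach G K a z)

    corner-separates : ∀ {M a c} → a ∉ K → a ∉ L → (∀ {z} → CornerBoundary a z → z ∈ M) →
      ¬ Corner a c → ¬ Reach G M a c
    corner-separates {M} {a} a∉K a∉L boundary⊆M ¬ac r =
      Reach-ind {P = ¬_ ∘ ¬_ ∘ Corner a} step (pure (Reach-refl a∉K , Reach-refl a∉L)) r ¬ac
      where
      extend : ∀ {y z} → Corner a y → y ~ z → z ∉ M → Dec (z ∈ K) → Dec (z ∈ L) → Corner a z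
      extend (_ , _)     e z∉M (yes z∈K) (yes z∈L) =
        contradiction (boundary⊆M (inj₂ (inj₁ (z∈K , z∈L)))) z∉M
      extend (_ , ayᴸ)   e z∉M (yes z∈K) (no z∉L)  =
        contradiction (boundary⊆M (inj₁ (z∈K , Reach-step ayᴸ e z∉L))) z∉M
      extend (ayᴷ , _)   e z∉M (no z∉K)  (yes z∈L) =
        contradiction (boundary⊆M (inj₂ (inj₂ (z∈L , Reach-step ayᴷ e z∉K)))) z∉M
      extend (ayᴷ , ayᴸ) e z∉M (no z∉K)  (no z∉L)  = Reach-step ayᴷ e z∉K , Reach-step ayᴸ e z∉L

      step : ∀ {y z} → ¬ ¬ Corner a y → y ~ z → z ∉ M → ¬ ¬ Corner a z
      step ¬¬ay e z∉M = do
        ay ← ¬¬ay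
        z∈K? ← ¬¬-excluded-middle
        z∈L? ← ¬¬-excluded-middle
        pure (extend ay e z∉M z∈K? z∈L?)

    corner-endCut : ∀ {M} (a c : AvoidingRay (K ++ L)) → M ⊆ K ++ L →
      (∀ {z} → CornerBoundary (start a) z → z ∈ M) → ¬ Corner (start a) (start c) → IsEndCut G M
    corner-endCut {M} a c M⊆K++L boundary⊆M ¬ac =
      (start a , start c , avoids aᴹ 0 , avoids cᴹ 0 , ¬ac-in-M) ,
      (start a , start c , avoids aᴹ 0 , avoids cᴹ 0 , ¬ac-in-M ,
       (ray a , ray-reach aᴹ) , (ray c , ray-reach cᴹ))
      where
      aᴹ cᴹ : AvoidingRay M
      aᴹ = restrict M⊆K++L a
      cᴹ = restrict M⊆K++L c
      ¬ac-in-M : ¬ Reach G M (start a) (start c)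
      ¬ac-in-M = corner-separates (avoids a 0 ∘ xs⊆xs++ys K L) (avoids a 0 ∘ xs⊆ys++xs L K) boundary⊆M ¬ac

    corner-bound : ∀ {PK PL : V → Set} → IsMincut G K → (a c : AvoidingRay (K ++ L)) →
      ¬ Corner (start a) (start c) → (dK : Decisions PK K) (dL : Decisions PL L) →
      (∀ {z} → CornerBoundary (start a) z → (z ∈ K × PK z) ⊎ (z ∈ L × PL z)) →
      length K ≤ count dK + count dL
    corner-bound (_ , _ , minimal) a c ¬ac dK dL boundary = begin
      length K             ≤⟨ minimal M (corner-endCut a c M⊆K++L boundary⊆M ¬ac) ⟩
      length M             ≡⟨ length-++ (select dK) ⟩
      count dK + count dL  ∎
      where
      open ≤-Reasoning hiding (start)
      M : List V
      M = select dK ++ select dL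
      M⊆K++L : M ⊆ K ++ L
      M⊆K++L = ++⁺ (select-⊆ dK) (select-⊆ dL)
      boundary⊆M : ∀ {z} → CornerBoundary (start a) z → z ∈ M
      boundary⊆M b = [ (λ (z∈K , pz) → ∈-++⁺ˡ (∈-select dK z∈K pz))
                     , (λ (z∈L , pz) → ∈-++⁺ʳ (select dK) (∈-select dL z∈L pz)) ]′ (boundary b)

  -- The corner bounds of a and b add up to at most |K| + (|L| - 1): each vertex of K is counted
  -- at most once, each vertex of L at most once, and x not at all.
  opposite-corners-cover : ∀ {K L x} → IsMincut G K → length L ≤ length K →
    (a b : AvoidingRay (K ++ L)) → ¬ Reach G K (start a) (start b) → ¬ Reach G L (start a) (start b) →
    x ∉ K → ¬ Reach G K (start a) x → ¬ Reach G K (start b) x → x ∉ L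
  opposite-corners-cover {K} {L} {x} mincut L≤K a b ¬Kab ¬Lab x∉K ¬Kax ¬Kbx = negated-stable do
    La? ← decisions (Reach G L (start a)) K
    Lb? ← decisions (Reach G L (start b)) K
    ∈L? ← decisions (_∈ L) K
    ∈K? ← decisions (_∈ K) L
    Ka? ← decisions (Reach G K (start a)) L
    Kb? ← decisions (Reach G K (start b)) L
    let corner-a : length K ≤ count La? + count (∈K? ∪? Ka?)
        corner-a = corner-bound mincut a b (¬Kab ∘ proj₁) La? (∈K? ∪? Ka?) λ where
          (inj₁ (z∈K , az))            → inj₁ (z∈K , az)
          (inj₂ (inj₁ (z∈K , z∈L)))    → inj₂ (z∈L , inj₁ z∈K)
          (inj₂ (inj₂ (z∈L , az)))     → inj₂ (z∈L , inj₂ az)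
        corner-b : length K ≤ count (∈L? ∪? Lb?) + count Kb?
        corner-b = corner-bound mincut b a (¬Kab ∘ Reach-sym ∘ proj₁) (∈L? ∪? Lb?) Kb? λ where
          (inj₁ (z∈K , bz))            → inj₁ (z∈K , inj₂ bz)
          (inj₂ (inj₁ (z∈K , z∈L)))    → inj₁ (z∈K , inj₁ z∈L)
          (inj₂ (inj₂ (z∈L , bz)))     → inj₂ (z∈L , bz)
        K-side : count La? + count (∈L? ∪? Lb?) ≤ length K
        K-side = ≤-trans (≤-reflexive (sym (count-∪ La? (∈L? ∪? Lb?) λ where
                   az (inj₁ z∈L) → Reach-end az z∈L
                   az (inj₂ bz)  → ¬Lab (Reach-trans az (Reach-sym bz)))))
                 (count≤length (La? ∪? (∈L? ∪? Lb?)))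
        L-side : x ∈ L → count (∈K? ∪? Ka?) + count Kb? < length K
        L-side = λ x∈L → begin-strict
          count (∈K? ∪? Ka?) + count Kb?  ≡⟨ sym (count-∪ (∈K? ∪? Ka?) Kb? λ where
                                               (inj₁ z∈K) bz → Reach-end bz z∈K
                                               (inj₂ az)  bz → ¬Kab (Reach-trans az (Reach-sym bz))) ⟩
          count ((∈K? ∪? Ka?) ∪? Kb?)     <⟨ count<length _ x∈L [ [ x∉K , ¬Kax ]′ , ¬Kbx ]′ ⟩
          length L                        ≤⟨ L≤K ⟩
          length K                        ∎
    pure λ x∈L → +-bounds-absurd (count La?) (count (∈K? ∪? Ka?)) (count (∈L? ∪? Lb?)) (count Kb?)
                   corner-a corner-b K-side (L-side x∈L)
    where open ≤-Reasoning hiding (start)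

  slice-∉-mincut : ∀ {K Q L x} → IsSlice G K Q → IsMincut G L → Q x → x ∉ L
  slice-∉-mincut {K} {Q} {L} {x} (mincutK@(_ , endCutK , _) , component , rayless)
                 (_ , endCutL , minimalL) qx =
    negated-stable do
      let (_ , d₁ , d₂ , _ , _ , ¬d₁d₂ , (σ₁ , σ₁∈) , (σ₂ , σ₂∈)) = endCutK
          (_ , l₁ , l₂ , _ , _ , ¬l₁l₂ , (ρ₁ , ρ₁∈) , (ρ₂ , ρ₂∈)) = endCutL
      (t₁ , l₁t₁) ← avoiding-tail (K ++ L) (Reach G L l₁) ρ₁ ρ₁∈
      (t₂ , l₂t₂) ← avoiding-tail (K ++ L) (Reach G L l₂) ρ₂ ρ₂∈
      (u₁ , d₁u₁) ← avoiding-tail (K ++ L) (Reach G K d₁) σ₁ σ₁∈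
      (u₂ , d₂u₂) ← avoiding-tail (K ++ L) (Reach G K d₂) σ₂ σ₂∈
      (a , b , ¬Lab , ¬Kab) ← separated-by-both {R = joinedBy L} {S = joinedBy K}
        Reach-sym Reach-trans Reach-sym Reach-trans t₁ t₂ u₁ u₂
        (Reach-separated ¬l₁l₂ l₁t₁ l₂t₂) (Reach-separated ¬d₁d₂ d₁u₁ d₂u₂)
      pure (opposite-corners-cover mincutK (minimalL K endCutK) a b ¬Kab ¬Lab
              (component-∌ component qx) (unreachable a) (unreachable b))
    where
    joinedBy : List V → AvoidingRay (K ++ L) → AvoidingRay (K ++ L) → Set
    joinedBy S a b = Reach G S (start a) (start b)

    unreachable : (a : AvoidingRay (K ++ L)) → ¬ Reach G K (start a) x
    unreachable a = rayless-unreachable component rayless qx (restrict (xs⊆xs++ys K L) a)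

  slice-⊆ : ∀ {K K′ Q Q′ x} → IsSlice G K Q → IsMincut G K′ → IsComponent G K′ Q′ →
    Q x → Q′ x → ∀ {w} → Q w → Q′ w
  slice-⊆ slice@(_ , component , _) mincut′ component′ qx q′x qw =
    let (walk , avoidsK) = component-reach component qx qw
    in  component-∋ component′ q′x
          (walk , All.map (slice-∉-mincut slice mincut′) (component-walk component qx walk avoidsK))

  slices-overlapping : ∀ {K K′ Q Q′ x} → IsSlice G K Q → IsSlice G K′ Q′ → Q x → Q′ x → SameSet G Q Q′
  slices-overlapping slice@(mincut , component , _) slice′@(mincut′ , component′ , _) qx q′x w =
    mk⇔ (slice-⊆ slice mincut′ component′ qx q′x) (slice-⊆ slice′ mincut component q′x qx)

  slice-boundary-unseparated : ∀ {K Q L x y} → IsSlice G K Q → IsMincut G L →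
    ∂ G Q x → ∂ G Q y → ¬ Separates G L x y
  slice-boundary-unseparated {L = L} slice@(_ , component , _) mincutL
                             (_ , x′ , qx′ , xx′) (_ , y′ , qy′ , yy′) separates =
    let (walk , avoidsK) = component-reach component qx′ qy′
        hit = subst (Any (_∈ L)) (inner-▷ xx′ walk (~-sym yy′)) (separates (xx′ ∷ (walk ▷ ~-sym yy′)))
        (qz , z∈L) = All.lookupAny (component-walk component qx′ walk avoidsK) hit
    in  slice-∉-mincut slice mincutL qz z∈L

mainTheorem6 : (G : Graph) → Connected G → EndCutsExist G →
    (∀ (K : List (Graph.V G)) Q → IsSlice G K Q →
       ∀ K′ → IsMincut G K′ → ∀ x → Q x → x ∈ K′ → ⊥)
    × (∀ (K K′ : List (Graph.V G)) Q Q′ → IsSlice G K Q → IsSlice G K′ Q′ →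
       ¬ SameSet G Q Q′ → ∀ x → Q x → Q′ x → ⊥)
    × (∀ (K : List (Graph.V G)) Q → IsSlice G K Q →
       ∀ L → IsMincut G L → ∀ x y → ∂ G Q x → ∂ G Q y → ¬ Separates G L x y)
mainTheorem6 G _ _ =
  (λ K Q slice K′ mincut′ x → slice-∉-mincut G slice mincut′)
  , (λ K K′ Q Q′ slice slice′ distinct x qx q′x → distinct (slices-overlapping G slice slice′ qx q′x))
  , (λ K Q slice L mincutL x y → slice-boundary-unseparated G slice mincutL)
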